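{- The lattice of subTuring degrees is not distributive; that is, there exist partial functions $f,g,h\colon\subseteq\omega\to\omega$ such that $f\oplus(g\cap h)\not\equiv_{\rm subT}(f\oplus g)\cap(f\oplus h)$.
   Context: For a partial computable function $\Phi$ from finite sequences of natural numbers to $\{0,1\}\times\omega$ and a partial function $g\colon\subseteq\omega\to\omega$, the $g$-relative sequential computation $\Phi[g]$ is defined as follows. On input $n$, with oracle answers $a_0,\dots,a_{s-1}$ obtained so far: if $\Phi(n,a_0,\dots,a_{s-1})$ is undefined, $\Phi[g](n)$ is undefined; if it equals $\langle 1,q\rangle$ the computation halts with output $q$; if it equals $\langle 0,q\rangle$, $q$ is a query, and if $q\in{\rm dom}(g)$ the computation continues with $a_s=g(q)$, while if $q\notin{\rm dom}(g)$ the computation never halts. $\Phi_e$ is the $e$-th such partial computable function. $f\leq_{\rm subT} g$ means $f\subseteq\Phi_e[g]$ for some $e$; $\equiv_{\rm subT}$ is mutual reducibility. The join is $(f\oplus g)(2n)=f(n)$, $(f\oplus g)(2n+1)=g(n)$, and the meet $f\cap g$ is $(f\cap g)(\langle d,e,n\rangle)=\Phi_d[f](n)$ if $\Phi_d[f](n)$ and $\Phi_e[g](n)$ are both defined and equal, undefined otherwise; these give the least upper bound and greatest lower bound in the subTuring degrees. -}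

module Defs where

open import Data.Nat using (ℕ; zero; suc; _+_; _*_; _∸_; _^_; _<_)
open import Data.List using (List; []; _∷_; _++_; [_])
open import Data.Product using (Σ; ∃; _×_; _,_)
open import Data.Sum using (_⊎_)
open import Relation.Binary.PropositionalEquality using (_≡_)

pair : ℕ → ℕ → ℕ
pair a b = (2 ^ a) * (2 * b + 1) ∸ 1

triple : ℕ → ℕ → ℕ → ℕ
triple d e n = pair d (pair e n)

seqCode : List ℕ → ℕ
seqCode []       = 0
seqCode (x ∷ xs) = suc (pair x (seqCode xs))

data Code : Set where
  zeroᶜ succᶜ : Code
  projᶜ : ℕ → Code
  compᶜ : Code → List Code → Code
  precᶜ : Code → Code → Code
  muᶜ   : Code → Code

hd : List ℕ → ℕ
hd []      = 0
hd (x ∷ _) = x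

nth : ℕ → List ℕ → ℕ
nth _       []       = 0
nth zero    (x ∷ _)  = x
nth (suc i) (_ ∷ xs) = nth i xs

mutual
  encode : Code → ℕ
  encode zeroᶜ        = pair 0 0
  encode succᶜ        = pair 1 0
  encode (projᶜ i)    = pair 2 i
  encode (compᶜ f gs) = pair 3 (pair (encode f) (encodeList gs))
  encode (precᶜ f g)  = pair 4 (pair (encode f) (encode g))
  encode (muᶜ f)      = pair 5 (encode f)

  encodeList : List Code → ℕ
  encodeList []       = 0
  encodeList (c ∷ cs) = suc (pair (encode c) (encodeList cs))

mutual
  data _⊢_⇓_ : Code → List ℕ → ℕ → Set where
    ev-zero : ∀ {xs} → zeroᶜ ⊢ xs ⇓ 0
    ev-succ : ∀ {xs} → succᶜ ⊢ xs ⇓ suc (hd xs)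
    ev-proj : ∀ {i xs} → projᶜ i ⊢ xs ⇓ nth i xs
    ev-comp : ∀ {f gs xs ys z} → gs ⊢* xs ⇓ ys → f ⊢ ys ⇓ z → compᶜ f gs ⊢ xs ⇓ z
    ev-prec-nil : ∀ {f g z} → f ⊢ [] ⇓ z → precᶜ f g ⊢ [] ⇓ z
    ev-prec-zero : ∀ {f g xs z} → f ⊢ xs ⇓ z → precᶜ f g ⊢ (0 ∷ xs) ⇓ z
    ev-prec-suc : ∀ {f g n xs r z} → precᶜ f g ⊢ (n ∷ xs) ⇓ r →
                  g ⊢ (n ∷ r ∷ xs) ⇓ z → precᶜ f g ⊢ (suc n ∷ xs) ⇓ z
    ev-mu : ∀ {f xs n} → f ⊢ (n ∷ xs) ⇓ 0 →
            (∀ m → m < n → Σ ℕ λ k → f ⊢ (m ∷ xs) ⇓ suc k) → muᶜ f ⊢ xs ⇓ n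

  data _⊢*_⇓_ : List Code → List ℕ → List ℕ → Set where
    ev-nil  : ∀ {xs} → [] ⊢* xs ⇓ []
    ev-cons : ∀ {g gs xs y ys} → g ⊢ xs ⇓ y → gs ⊢* xs ⇓ ys → (g ∷ gs) ⊢* xs ⇓ (y ∷ ys)

-- Φ e σ ⇓ y : the e-th partial computable function on finite sequences,
-- applied to σ, halts with value y.  Indices not coding a program give
-- the empty function.
Φ_⟨_⟩⇓_ : ℕ → List ℕ → ℕ → Set
Φ e ⟨ σ ⟩⇓ y = Σ Code λ c → encode c ≡ e × c ⊢ [ seqCode σ ] ⇓ y

-- Values of Φ are coded: ⟨1,q⟩ (halt with q) as 2q+1, ⟨0,q⟩ (query q) as 2q.

PFun : Set₁
PFun = ℕ → ℕ → Set

IsPartialFun : PFun → Set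
IsPartialFun f = ∀ {n a b} → f n a → f n b → a ≡ b

data Run (e : ℕ) (g : PFun) (n : ℕ) : List ℕ → ℕ → Set where
  run-halt  : ∀ {as q} → Φ e ⟨ n ∷ as ⟩⇓ (2 * q + 1) → Run e g n as q
  run-query : ∀ {as p a q} → Φ e ⟨ n ∷ as ⟩⇓ (2 * p) → g p a →
              Run e g n (as ++ [ a ]) q → Run e g n as q

Φ_[_] : ℕ → PFun → PFun
Φ e [ g ] n q = Run e g n [] q

_≤subT_ : PFun → PFun → Set
f ≤subT g = Σ ℕ λ e → ∀ n y → f n y → Φ e [ g ] n y

_≡subT_ : PFun → PFun → Set
f ≡subT g = (f ≤subT g) × (g ≤subT f)

_⊕_ : PFun → PFun → PFun
(f ⊕ g) m y = (Σ ℕ λ n → m ≡ 2 * n × f n y) ⊎ (Σ ℕ λ n → m ≡ 2 * n + 1 × g n y)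

_∩_ : PFun → PFun → PFun
(f ∩ g) m y = Σ ℕ λ d → Σ ℕ λ e → Σ ℕ λ n →
  m ≡ triple d e n × Φ d [ f ] n y × Φ e [ g ] n y

{-# OPTIONS --safe #-}
-- A condition approximates g by σ and h by τ + 2, and sets f(2k + τ[k]) = σ[k]; one program then
-- reads g(k) from f ⊕ g and from f ⊕ h alike, so g(k) is the value of (f ⊕ g) ∩ (f ⊕ h) at a
-- probe point x_k.  Values of g ∩ h are fixed by its h-side computations, so g matters to
-- f ⊕ (g ∩ h) only through domains: while τ[k] = 0, the oracles for g(k) = 0 and g(k) = 1 agree
-- wherever both are defined, except at f(2k).  Hence if the E-th reduction to f ⊕ (g ∩ h) outputs
-- g(k) correctly in both cases, it queries f(2k), and setting τ[k] = 1 leaves f(2k) undefined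
-- forever; otherwise it already diverges or errs at x_k.  These choices use excluded middle, so
-- the generic sequence of conditions is a relation (least code at each stage) that exists only
-- under double negation, which suffices for the negative conclusion.

module Submission where

open import Defs
open import Data.Nat
  using (ℕ; zero; suc; _+_; _*_; _∸_; _^_; _≤_; _<_; z≤n; s≤s; _≤′_; ≤′-refl; ≤′-step; _≟_; pred; NonZero)
open import Data.Nat.Properties
open import Data.Nat.Induction using (<-rec)
open import Data.List using (List; []; _∷_; _++_; [_]; length)
open import Data.List.Relation.Binary.Prefix.Heterogeneous using (Prefix; []; _∷_)
open import Data.List.Relation.Binary.Prefix.Heterogeneous.Properties using () renaming (trans to Prefix-trans)
open import Data.Product using (Σ; ∃; ∃₂; _×_; _,_; proj₁; proj₂)
open import Data.Sum using (_⊎_; inj₁; inj₂)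
open import Relation.Nullary using (¬_; Dec; yes; no; contradiction)
open import Relation.Nullary.Negation using (¬¬-Monad)
open import Relation.Nullary.Decidable using (¬¬-excluded-middle)
open import Effect.Monad using (RawMonad)
open import Level using (0ℓ)
open import Function using (id)
open import Relation.Binary.PropositionalEquality hiding ([_])
open import Relation.Binary.Core using (_⇒_)
open import Relation.Binary.Definitions using (tri<; tri≈; tri>)

open RawMonad (¬¬-Monad {a = 0ℓ}) using (pure; _>>=_)

odd-injective : ∀ {m n} → 2 * m + 1 ≡ 2 * n + 1 → m ≡ n
odd-injective {m} {n} eq = *-cancelˡ-≡ m n 2 (+-cancelʳ-≡ 1 (2 * m) (2 * n) eq)

even≢odd′ : ∀ m n → 2 * m ≢ 2 * n + 1
even≢odd′ m n eq = even≢odd m n (trans eq (+-comm (2 * n) 1))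

power-odd-injective : ∀ a b a′ b′ → 2 ^ a * (2 * b + 1) ≡ 2 ^ a′ * (2 * b′ + 1) → a ≡ a′ × b ≡ b′
power-odd-injective zero b zero b′ eq =
  refl , odd-injective (trans (sym (*-identityˡ _)) (trans eq (*-identityˡ _)))
power-odd-injective zero b (suc a′) b′ eq =
  contradiction (trans (sym (*-assoc 2 (2 ^ a′) _)) (trans (sym eq) (*-identityˡ _)))
                (even≢odd′ (2 ^ a′ * (2 * b′ + 1)) b)
power-odd-injective (suc a) b zero b′ eq =
  contradiction (trans (sym (*-assoc 2 (2 ^ a) _)) (trans eq (*-identityˡ _)))
                (even≢odd′ (2 ^ a * (2 * b + 1)) b′)
power-odd-injective (suc a) b (suc a′) b′ eq =
  let a≡a′ , b≡b′ = power-odd-injective a b a′ b′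
                      (*-cancelˡ-≡ _ _ 2 (trans (sym (*-assoc 2 (2 ^ a) _)) (trans eq (*-assoc 2 (2 ^ a′) _))))
  in cong suc a≡a′ , b≡b′

power-odd-nonZero : ∀ a b → NonZero (2 ^ a * (2 * b + 1))
power-odd-nonZero a b = m*n≢0 (2 ^ a) (2 * b + 1) {{m^n≢0 2 a}} {{subst NonZero (+-comm 1 (2 * b)) _}}

pair-injective : ∀ {a b a′ b′} → pair a b ≡ pair a′ b′ → a ≡ a′ × b ≡ b′
pair-injective {a} {b} {a′} {b′} eq = power-odd-injective a b a′ b′
  (pred-injective {{power-odd-nonZero a b}} {{power-odd-nonZero a′ b′}} eq)

triple-injective : ∀ {d e n d′ e′ n′} → triple d e n ≡ triple d′ e′ n′ → d ≡ d′ × e ≡ e′ × n ≡ n′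
triple-injective eq =
  let d≡d′ , rest = pair-injective eq
      e≡e′ , n≡n′ = pair-injective rest
  in d≡d′ , e≡e′ , n≡n′

seqCode-injective : ∀ {xs ys} → seqCode xs ≡ seqCode ys → xs ≡ ys
seqCode-injective {[]}     {[]}     _  = refl
seqCode-injective {x ∷ xs} {y ∷ ys} eq =
  let x≡y , rest = pair-injective (suc-injective eq)
  in cong₂ _∷_ x≡y (seqCode-injective rest)

-- A TagView turns equality of tags into equality of head constructors.
private
  tag : Code → ℕ
  tag zeroᶜ       = 0
  tag succᶜ       = 1
  tag (projᶜ _)   = 2
  tag (compᶜ _ _) = 3
  tag (precᶜ _ _) = 4
  tag (muᶜ _)     = 5

  payload : Code → ℕ
  payload zeroᶜ        = 0
  payload succᶜ        = 0
  payload (projᶜ i)    = i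
  payload (compᶜ f gs) = pair (encode f) (encodeList gs)
  payload (precᶜ f g)  = pair (encode f) (encode g)
  payload (muᶜ f)      = encode f

  encode-tag-payload : ∀ c → encode c ≡ pair (tag c) (payload c)
  encode-tag-payload zeroᶜ       = refl
  encode-tag-payload succᶜ       = refl
  encode-tag-payload (projᶜ _)   = refl
  encode-tag-payload (compᶜ _ _) = refl
  encode-tag-payload (precᶜ _ _) = refl
  encode-tag-payload (muᶜ _)     = refl

  data TagView : ℕ → Code → Set where
    zeroᵛ : TagView 0 zeroᶜ
    succᵛ : TagView 1 succᶜ
    projᵛ : ∀ i → TagView 2 (projᶜ i)
    compᵛ : ∀ f gs → TagView 3 (compᶜ f gs)
    precᵛ : ∀ f g → TagView 4 (precᶜ f g)
    muᵛ   : ∀ f → TagView 5 (muᶜ f)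

  tagView : ∀ c → TagView (tag c) c
  tagView zeroᶜ        = zeroᵛ
  tagView succᶜ        = succᵛ
  tagView (projᶜ i)    = projᵛ i
  tagView (compᶜ f gs) = compᵛ f gs
  tagView (precᶜ f g)  = precᵛ f g
  tagView (muᶜ f)      = muᵛ f

mutual
  encode-injective : ∀ {c c′} → encode c ≡ encode c′ → c ≡ c′
  encode-injective {c} {c′} eq =
    let tag≡ , payload≡ = pair-injective (trans (sym (encode-tag-payload c)) (trans eq (encode-tag-payload c′)))
    in same-tag c (subst (λ t → TagView t c′) (sym tag≡) (tagView c′)) payload≡

  encodeList-injective : ∀ {cs cs′} → encodeList cs ≡ encodeList cs′ → cs ≡ cs′
  encodeList-injective {[]}     {[]}      _  = refl
  encodeList-injective {c ∷ cs} {c′ ∷ cs′} eq =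
    let c≡ , cs≡ = pair-injective (suc-injective eq)
    in cong₂ _∷_ (encode-injective c≡) (encodeList-injective cs≡)

  private
    same-tag : ∀ c {c′} → TagView (tag c) c′ → payload c ≡ payload c′ → c ≡ c′
    same-tag zeroᶜ        zeroᵛ       _  = refl
    same-tag succᶜ        succᵛ       _  = refl
    same-tag (projᶜ i)    (projᵛ _)   eq = cong projᶜ eq
    same-tag (compᶜ f gs) (compᵛ _ _) eq =
      let f≡ , gs≡ = pair-injective eq in cong₂ compᶜ (encode-injective f≡) (encodeList-injective gs≡)
    same-tag (precᶜ f g)  (precᵛ _ _) eq =
      let f≡ , g≡ = pair-injective eq in cong₂ precᶜ (encode-injective f≡) (encode-injective g≡)
    same-tag (muᶜ f)      (muᵛ _)     eq = cong muᶜ (encode-injective eq)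

mutual
  ⇓-functional : ∀ {c xs y y′} → c ⊢ xs ⇓ y → c ⊢ xs ⇓ y′ → y ≡ y′
  ⇓-functional ev-zero ev-zero = refl
  ⇓-functional ev-succ ev-succ = refl
  ⇓-functional ev-proj ev-proj = refl
  ⇓-functional (ev-comp gs f) (ev-comp gs′ f′) with refl ← ⇓*-functional gs gs′ = ⇓-functional f f′
  ⇓-functional (ev-prec-nil b) (ev-prec-nil b′) = ⇓-functional b b′
  ⇓-functional (ev-prec-zero b) (ev-prec-zero b′) = ⇓-functional b b′
  ⇓-functional (ev-prec-suc r s) (ev-prec-suc r′ s′) with refl ← ⇓-functional r r′ = ⇓-functional s s′
  ⇓-functional (ev-mu {n = n} z below) (ev-mu {n = n′} z′ below′) with <-cmp n n′
  ... | tri< n<n′ _ _ = contradiction (⇓-functional z (proj₂ (below′ n n<n′))) 0≢1+n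
  ... | tri≈ _ n≡n′ _ = n≡n′
  ... | tri> _ _ n′<n = contradiction (⇓-functional z′ (proj₂ (below n′ n′<n))) 0≢1+n

  ⇓*-functional : ∀ {gs xs ys ys′} → gs ⊢* xs ⇓ ys → gs ⊢* xs ⇓ ys′ → ys ≡ ys′
  ⇓*-functional ev-nil ev-nil = refl
  ⇓*-functional (ev-cons g gs) (ev-cons g′ gs′) = cong₂ _∷_ (⇓-functional g g′) (⇓*-functional gs gs′)

Φ-functional : ∀ {e σ y y′} → Φ e ⟨ σ ⟩⇓ y → Φ e ⟨ σ ⟩⇓ y′ → y ≡ y′
Φ-functional (c , refl , c⇓y) (c′ , c′≡ , c′⇓y′) with refl ← encode-injective {c′} {c} c′≡ =
  ⇓-functional c⇓y c′⇓y′

Run-mono : ∀ {e O₁ O₂ n as q} → O₁ ⇒ O₂ → Run e O₁ n as q → Run e O₂ n as q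
Run-mono O₁⇒O₂ (run-halt φ)      = run-halt φ
Run-mono O₁⇒O₂ (run-query φ o r) = run-query φ (O₁⇒O₂ o) (Run-mono O₁⇒O₂ r)

data Queries {e O n} : ∀ {as q} → Run e O n as q → ℕ → Set where
  now   : ∀ {as p a q φ o} {r : Run e O n (as ++ [ a ]) q} → Queries (run-query {as = as} {p} φ o r) p
  later : ∀ {as p a q φ o p′} {r : Run e O n (as ++ [ a ]) q} →
          Queries r p′ → Queries (run-query {as = as} {p} φ o r) p′

Compatible : PFun → PFun → Set
Compatible O₁ O₂ = ∀ {p a₁ a₂} → O₁ p a₁ → O₂ p a₂ → a₁ ≡ a₂

CompatibleOff : ℕ → PFun → PFun → Set
CompatibleOff p₀ O₁ O₂ = ∀ {p a₁ a₂} → p ≢ p₀ → O₁ p a₁ → O₂ p a₂ → a₁ ≡ a₂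

module _ {e : ℕ} {O₁ O₂ : PFun} {n : ℕ} where

  AnsweredBy : ∀ {as q} → Run e O₁ n as q → PFun → Set
  AnsweredBy r O = ∀ {p} → Queries r p → ∃ (O p)

  AnsweredDifferently : ∀ {as q} → Run e O₁ n as q → Set
  AnsweredDifferently r = ∃ λ p → Queries r p × ∃₂ λ a₁ a₂ → O₁ p a₁ × O₂ p a₂ × a₁ ≢ a₂

  run-comparison : ∀ {as q₁ q₂} (r₁ : Run e O₁ n as q₁) → Run e O₂ n as q₂ →
                   (q₁ ≡ q₂ × AnsweredBy r₁ O₂) ⊎ AnsweredDifferently r₁
  run-comparison {as} (run-halt φ₁) (run-halt φ₂) =
    inj₁ (odd-injective (Φ-functional {e} {n ∷ as} φ₁ φ₂) , λ ())
  run-comparison {as} (run-halt {q = q} φ₁) (run-query {p = p} φ₂ _ _) =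
    contradiction (Φ-functional {e} {n ∷ as} φ₂ φ₁) (even≢odd′ p q)
  run-comparison {as} (run-query {p = p} φ₁ _ _) (run-halt {q = q} φ₂) =
    contradiction (Φ-functional {e} {n ∷ as} φ₁ φ₂) (even≢odd′ p q)
  run-comparison {as} (run-query {p = p} {a₁} φ₁ o₁ r₁) (run-query {p = p′} {a₂} φ₂ o₂ r₂)
    with refl ← *-cancelˡ-≡ p p′ 2 (Φ-functional {e} {n ∷ as} φ₁ φ₂) | a₁ ≟ a₂
  ... | no a₁≢a₂ = inj₂ (p , now , a₁ , a₂ , o₁ , o₂ , a₁≢a₂)
  ... | yes refl with run-comparison r₁ r₂
  ...   | inj₁ (q₁≡q₂ , answered) = inj₁ (q₁≡q₂ , λ { now → a₁ , o₂ ; (later qu) → answered qu })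
  ...   | inj₂ (p″ , qu , different) = inj₂ (p″ , later qu , different)

  queries-answered : ∀ {as q₁ q₂} → Compatible O₁ O₂ → (r₁ : Run e O₁ n as q₁) → Run e O₂ n as q₂ →
                     AnsweredBy r₁ O₂
  queries-answered compatible r₁ r₂ with run-comparison r₁ r₂
  ... | inj₁ (_ , answered) = answered
  ... | inj₂ (_ , _ , _ , _ , o₁ , o₂ , a₁≢a₂) = contradiction (compatible o₁ o₂) a₁≢a₂

  different-runs-query : ∀ {as q₁ q₂} p₀ → CompatibleOff p₀ O₁ O₂ → (r₁ : Run e O₁ n as q₁) → Run e O₂ n as q₂ →
                         q₁ ≢ q₂ → Queries r₁ p₀
  different-runs-query p₀ compatible r₁ r₂ q₁≢q₂ with run-comparison r₁ r₂
  ... | inj₁ (q₁≡q₂ , _) = contradiction q₁≡q₂ q₁≢q₂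
  ... | inj₂ (p , qu , _ , _ , o₁ , o₂ , a₁≢a₂) with p ≟ p₀
  ...   | yes refl = qu
  ...   | no p≢p₀ = contradiction (compatible p≢p₀ o₁ o₂) a₁≢a₂

Run-functional : ∀ {e O n as q₁ q₂} → IsPartialFun O → Run e O n as q₁ → Run e O n as q₂ → q₁ ≡ q₂
Run-functional partial r₁ r₂ with run-comparison r₁ r₂
... | inj₁ (q₁≡q₂ , _) = q₁≡q₂
... | inj₂ (_ , _ , _ , _ , o₁ , o₂ , a₁≢a₂) = contradiction (partial o₁ o₂) a₁≢a₂

module _ {F₁ F₂ G₁ G₂ : PFun} where

  ⊕-mono : F₁ ⇒ F₂ → G₁ ⇒ G₂ → (F₁ ⊕ G₁) ⇒ (F₂ ⊕ G₂)
  ⊕-mono F₁⇒F₂ _ (inj₁ (n , eq , x)) = inj₁ (n , eq , F₁⇒F₂ x)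
  ⊕-mono _ G₁⇒G₂ (inj₂ (n , eq , x)) = inj₂ (n , eq , G₁⇒G₂ x)

  ∩-mono : F₁ ⇒ F₂ → G₁ ⇒ G₂ → (F₁ ∩ G₁) ⇒ (F₂ ∩ G₂)
  ∩-mono F₁⇒F₂ G₁⇒G₂ (d , e , n , eq , φ , ψ) = d , e , n , eq , Run-mono F₁⇒F₂ φ , Run-mono G₁⇒G₂ ψ

  ⊕-compatible : Compatible F₁ F₂ → Compatible G₁ G₂ → Compatible (F₁ ⊕ G₁) (F₂ ⊕ G₂)
  ⊕-compatible F₁~F₂ _ (inj₁ (n , refl , x)) (inj₁ (n′ , eq , y))
    with refl ← *-cancelˡ-≡ n n′ 2 eq = F₁~F₂ x y
  ⊕-compatible _ _ (inj₁ (n , refl , _)) (inj₂ (n′ , eq , _)) = contradiction eq (even≢odd′ n n′)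
  ⊕-compatible _ _ (inj₂ (n , refl , _)) (inj₁ (n′ , eq , _)) = contradiction (sym eq) (even≢odd′ n′ n)
  ⊕-compatible _ G₁~G₂ (inj₂ (n , refl , x)) (inj₂ (n′ , eq , y))
    with refl ← odd-injective {n} {n′} eq = G₁~G₂ x y

  ⊕-compatibleOff : ∀ {p₀} → CompatibleOff p₀ F₁ F₂ → Compatible G₁ G₂ →
                    CompatibleOff (2 * p₀) (F₁ ⊕ G₁) (F₂ ⊕ G₂)
  ⊕-compatibleOff F₁~F₂ _ p≢ (inj₁ (n , refl , x)) (inj₁ (n′ , eq , y))
    with refl ← *-cancelˡ-≡ n n′ 2 eq = F₁~F₂ (λ n≡p₀ → p≢ (cong (2 *_) n≡p₀)) x y
  ⊕-compatibleOff _ _ _ (inj₁ (n , refl , _)) (inj₂ (n′ , eq , _)) = contradiction eq (even≢odd′ n n′)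
  ⊕-compatibleOff _ _ _ (inj₂ (n , refl , _)) (inj₁ (n′ , eq , _)) = contradiction (sym eq) (even≢odd′ n′ n)
  ⊕-compatibleOff _ G₁~G₂ _ (inj₂ (n , refl , x)) (inj₂ (n′ , eq , y))
    with refl ← odd-injective {n} {n′} eq = G₁~G₂ x y

  ∩-compatibleˡ : F₁ ⇒ F₂ → IsPartialFun F₂ → Compatible (F₁ ∩ G₁) (F₂ ∩ G₂)
  ∩-compatibleˡ F₁⇒F₂ partial (d , e , n , refl , φ , _) (d′ , e′ , n′ , eq , φ′ , _)
    with refl , refl , refl ← triple-injective {d} {e} {n} {d′} {e′} {n′} eq =
    Run-functional partial (Run-mono F₁⇒F₂ φ) φ′

  ∩-compatibleʳ : G₁ ⇒ G₂ → IsPartialFun G₂ → Compatible (F₁ ∩ G₁) (F₂ ∩ G₂)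
  ∩-compatibleʳ G₁⇒G₂ partial (d , e , n , refl , _ , ψ) (d′ , e′ , n′ , eq , _ , ψ′)
    with refl , refl , refl ← triple-injective {d} {e} {n} {d′} {e′} {n′} eq =
    Run-functional partial (Run-mono G₁⇒G₂ ψ) ψ′

⊕-partial : ∀ {F G} → IsPartialFun F → IsPartialFun G → IsPartialFun (F ⊕ G)
⊕-partial = ⊕-compatible

∩-partial : ∀ {F G} → IsPartialFun F → IsPartialFun (F ∩ G)
∩-partial = ∩-compatibleˡ id

constᶜ : ℕ → Code
constᶜ zero    = zeroᶜ
constᶜ (suc n) = compᶜ succᶜ [ constᶜ n ]

constᶜ-⇓ : ∀ n {xs} → constᶜ n ⊢ xs ⇓ n
constᶜ-⇓ zero    = ev-zero
constᶜ-⇓ (suc n) = ev-comp (ev-cons (constᶜ-⇓ n) ev-nil) ev-succ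

binaryᶜ : Code → Code → Code → Code
binaryᶜ F G H = compᶜ F (G ∷ H ∷ [])

binaryᶜ-⇓ : ∀ {F G H xs a b z} → F ⊢ (a ∷ b ∷ []) ⇓ z → G ⊢ xs ⇓ a → H ⊢ xs ⇓ b → binaryᶜ F G H ⊢ xs ⇓ z
binaryᶜ-⇓ F⇓ G⇓ H⇓ = ev-comp (ev-cons G⇓ (ev-cons H⇓ ev-nil)) F⇓

addᶜ : Code
addᶜ = precᶜ (projᶜ 0) (compᶜ succᶜ [ projᶜ 1 ])

addᶜ-⇓ : ∀ m n → addᶜ ⊢ (m ∷ n ∷ []) ⇓ (m + n)
addᶜ-⇓ zero    n = ev-prec-zero ev-proj
addᶜ-⇓ (suc m) n = ev-prec-suc (addᶜ-⇓ m n) (ev-comp (ev-cons ev-proj ev-nil) ev-succ)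

predᶜ : Code
predᶜ = precᶜ zeroᶜ (projᶜ 0)

predᶜ-⇓ : ∀ n → predᶜ ⊢ [ n ] ⇓ pred n
predᶜ-⇓ zero    = ev-prec-zero ev-zero
predᶜ-⇓ (suc n) = ev-prec-suc (predᶜ-⇓ n) ev-proj

monusᶜ : Code
monusᶜ = precᶜ (projᶜ 0) (compᶜ predᶜ [ projᶜ 1 ])

monusᶜ-⇓ : ∀ m n → monusᶜ ⊢ (m ∷ n ∷ []) ⇓ (n ∸ m)
monusᶜ-⇓ zero    n = ev-prec-zero ev-proj
monusᶜ-⇓ (suc m) n = ev-prec-suc (monusᶜ-⇓ m n)
  (subst (λ z → compᶜ predᶜ [ projᶜ 1 ] ⊢ (m ∷ n ∸ m ∷ n ∷ []) ⇓ z) (pred[m∸n]≡m∸[1+n] n m)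
    (ev-comp (ev-cons ev-proj ev-nil) (predᶜ-⇓ (n ∸ m))))

distanceᶜ : ℕ → Code
distanceᶜ c = binaryᶜ addᶜ (binaryᶜ monusᶜ (constᶜ c) (projᶜ 0)) (binaryᶜ monusᶜ (projᶜ 0) (constᶜ c))

distanceᶜ-⇓ : ∀ c x → distanceᶜ c ⊢ [ x ] ⇓ ((x ∸ c) + (c ∸ x))
distanceᶜ-⇓ c x = binaryᶜ-⇓ (addᶜ-⇓ _ _)
  (binaryᶜ-⇓ (monusᶜ-⇓ c x) (constᶜ-⇓ c) ev-proj)
  (binaryᶜ-⇓ (monusᶜ-⇓ x c) ev-proj (constᶜ-⇓ c))

ifZero : ℕ → ℕ → ℕ → ℕ
ifZero zero    t _ = t
ifZero (suc _) _ e = e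

ifZeroᶜ : Code → Code → Code → Code
ifZeroᶜ B T E = compᶜ (precᶜ T (compᶜ E [ projᶜ 2 ])) (B ∷ projᶜ 0 ∷ [])

ifZeroᶜ-⇓ : ∀ {B T E x b t e} → B ⊢ [ x ] ⇓ b → T ⊢ [ x ] ⇓ t → E ⊢ [ x ] ⇓ e →
            ifZeroᶜ B T E ⊢ [ x ] ⇓ ifZero b t e
ifZeroᶜ-⇓ {B} {T} {E} {x} {b} {t} {e} B⇓ T⇓ E⇓ = ev-comp (ev-cons B⇓ (ev-cons ev-proj ev-nil)) (branch b)
  where
  branch : ∀ b → precᶜ T (compᶜ E [ projᶜ 2 ]) ⊢ (b ∷ x ∷ []) ⇓ ifZero b t e
  branch zero    = ev-prec-zero T⇓
  branch (suc b) = ev-prec-suc (branch b) (ev-comp (ev-cons ev-proj ev-nil) E⇓)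

Table : Set
Table = List (ℕ × ℕ)

lookupᵗ : Table → ℕ → ℕ
lookupᵗ []            _ = 0
lookupᵗ ((c , v) ∷ t) x = ifZero ((x ∸ c) + (c ∸ x)) v (lookupᵗ t x)

tableᶜ : Table → Code
tableᶜ []            = zeroᶜ
tableᶜ ((c , v) ∷ t) = ifZeroᶜ (distanceᶜ c) (constᶜ v) (tableᶜ t)

tableᶜ-⇓ : ∀ t x → tableᶜ t ⊢ [ x ] ⇓ lookupᵗ t x
tableᶜ-⇓ []            x = ev-zero
tableᶜ-⇓ ((c , v) ∷ t) x = ifZeroᶜ-⇓ (distanceᶜ-⇓ c x) (constᶜ-⇓ v) (tableᶜ-⇓ t x)

halt query : ℕ → ℕ
halt q  = 2 * q + 1
query p = 2 * p

-- Keyed by the code of the input 0 followed by the answers so far.  On oracle f ⊕ g it asks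
-- g(k) ∈ {0,1} and returns it; on f ⊕ h it asks h(k) = β + 2, then f(2k + β), and returns that.
decoderTable : ℕ → Table
decoderTable k =
  (seqCode (0 ∷ []) , query (2 * k + 1)) ∷
  (seqCode (0 ∷ 0 ∷ []) , halt 0) ∷
  (seqCode (0 ∷ 1 ∷ []) , halt 1) ∷
  (seqCode (0 ∷ 2 ∷ []) , query (2 * (2 * k + 0))) ∷
  (seqCode (0 ∷ 3 ∷ []) , query (2 * (2 * k + 1))) ∷
  (seqCode (0 ∷ 2 ∷ 0 ∷ []) , halt 0) ∷
  (seqCode (0 ∷ 2 ∷ 1 ∷ []) , halt 1) ∷
  (seqCode (0 ∷ 3 ∷ 0 ∷ []) , halt 0) ∷
  (seqCode (0 ∷ 3 ∷ 1 ∷ []) , halt 1) ∷ []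

-- Opaque because program codes are towers of exponentials that must never be normalised.
opaque
  decoder : ℕ → ℕ
  decoder k = encode (tableᶜ (decoderTable k))

  decoder-⇓ : ∀ k σ → Φ decoder k ⟨ σ ⟩⇓ lookupᵗ (decoderTable k) (seqCode σ)
  decoder-⇓ k σ = tableᶜ (decoderTable k) , refl , tableᶜ-⇓ (decoderTable k) (seqCode σ)

decoder-⊕ʳ : ∀ {F G} k a → a ≤ 1 → G k a → Φ decoder k [ F ⊕ G ] 0 a
decoder-⊕ʳ k a a≤1 Gka =
  run-query {p = 2 * k + 1} (decoder-⇓ k (0 ∷ [])) (inj₂ (k , refl , Gka)) (run-halt (answer a≤1))
  where
  answer : ∀ {a} → a ≤ 1 → Φ decoder k ⟨ 0 ∷ a ∷ [] ⟩⇓ halt a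
  answer z≤n       = decoder-⇓ k (0 ∷ 0 ∷ [])
  answer (s≤s z≤n) = decoder-⇓ k (0 ∷ 1 ∷ [])

decoder-⊕-via : ∀ {F H} k a β → a ≤ 1 → β ≤ 1 → H k (β + 2) → F (2 * k + β) a → Φ decoder k [ F ⊕ H ] 0 a
decoder-⊕-via k a β a≤1 β≤1 Hk Fa =
  run-query {p = 2 * k + 1} (decoder-⇓ k (0 ∷ [])) (inj₂ (k , refl , Hk))
    (run-query {p = 2 * (2 * k + β)} (second-query β≤1) (inj₁ (2 * k + β , refl , Fa))
      (run-halt (answer β≤1 a≤1)))
  where
  second-query : ∀ {β} → β ≤ 1 → Φ decoder k ⟨ 0 ∷ β + 2 ∷ [] ⟩⇓ query (2 * (2 * k + β))
  second-query z≤n       = decoder-⇓ k (0 ∷ 2 ∷ [])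
  second-query (s≤s z≤n) = decoder-⇓ k (0 ∷ 3 ∷ [])

  answer : ∀ {β a} → β ≤ 1 → a ≤ 1 → Φ decoder k ⟨ 0 ∷ β + 2 ∷ a ∷ [] ⟩⇓ halt a
  answer z≤n       z≤n       = decoder-⇓ k (0 ∷ 2 ∷ 0 ∷ [])
  answer z≤n       (s≤s z≤n) = decoder-⇓ k (0 ∷ 2 ∷ 1 ∷ [])
  answer (s≤s z≤n) z≤n       = decoder-⇓ k (0 ∷ 3 ∷ 0 ∷ [])
  answer (s≤s z≤n) (s≤s z≤n) = decoder-⇓ k (0 ∷ 3 ∷ 1 ∷ [])

infix 4 _⊑_ _[_]=_
infixl 5 _[_]≔_

_⊑_ : List ℕ → List ℕ → Set
_⊑_ = Prefix _≡_

⊑-refl : ∀ {xs} → xs ⊑ xs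
⊑-refl {[]}     = []
⊑-refl {x ∷ xs} = refl ∷ ⊑-refl

⊑-trans : ∀ {xs ys zs} → xs ⊑ ys → ys ⊑ zs → xs ⊑ zs
⊑-trans = Prefix-trans trans

data _[_]=_ : List ℕ → ℕ → ℕ → Set where
  here  : ∀ {x xs} → (x ∷ xs) [ 0 ]= x
  there : ∀ {x xs i y} → xs [ i ]= y → (x ∷ xs) [ suc i ]= y

[]=-functional : ∀ {xs i a b} → xs [ i ]= a → xs [ i ]= b → a ≡ b
[]=-functional here      here      = refl
[]=-functional (there a) (there b) = []=-functional a b

[]=-mono : ∀ {xs ys i y} → xs ⊑ ys → xs [ i ]= y → ys [ i ]= y
[]=-mono (refl ∷ _)  here      = here
[]=-mono (_ ∷ xs⊑ys) (there a) = there ([]=-mono xs⊑ys a)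

_[_]≔_ : List ℕ → ℕ → ℕ → List ℕ
[]       [ _ ]≔ _     = []
(x ∷ xs) [ zero ]≔ v  = v ∷ xs
(x ∷ xs) [ suc k ]≔ v = x ∷ (xs [ k ]≔ v)

[]≔-updated : ∀ {xs k u v} → xs [ k ]= u → (xs [ k ]≔ v) [ k ]= v
[]≔-updated here      = here
[]≔-updated (there a) = there ([]≔-updated a)

[]≔-other : ∀ {xs k v i y} → i ≢ k → (xs [ k ]≔ v) [ i ]= y → xs [ i ]= y
[]≔-other {_ ∷ _} {zero}  i≢k here      = contradiction refl i≢k
[]≔-other {_ ∷ _} {zero}  _   (there a) = there a
[]≔-other {_ ∷ _} {suc k} _   here      = here
[]≔-other {_ ∷ _} {suc k} i≢k (there a) = there ([]≔-other (λ i≡k → i≢k (cong suc i≡k)) a)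

⊑-[]≔-beyond : ∀ {xs ys k v} → xs ⊑ ys → length xs ≤ k → xs ⊑ ys [ k ]≔ v
⊑-[]≔-beyond             []             _           = []
⊑-[]≔-beyond {k = suc k} (refl ∷ xs⊑ys) (s≤s len≤k) = refl ∷ ⊑-[]≔-beyond xs⊑ys len≤k

⊑-[]≔-restore : ∀ {xs ys k u v} → xs [ k ]= u → xs [ k ]≔ v ⊑ ys → xs ⊑ ys [ k ]≔ u
⊑-[]≔-restore here      (refl ∷ xs⊑ys) = refl ∷ xs⊑ys
⊑-[]≔-restore (there a) (refl ∷ xs⊑ys) = refl ∷ ⊑-[]≔-restore a xs⊑ys

padTo : List ℕ → ℕ → List ℕ
padTo []       zero    = [ 0 ]
padTo []       (suc k) = 0 ∷ padTo [] k
padTo (x ∷ xs) zero    = x ∷ xs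
padTo (x ∷ xs) (suc k) = x ∷ padTo xs k

⊑-padTo : ∀ xs k → xs ⊑ padTo xs k
⊑-padTo []       _       = []
⊑-padTo (x ∷ xs) zero    = ⊑-refl
⊑-padTo (x ∷ xs) (suc k) = refl ∷ ⊑-padTo xs k

padTo-[]= : ∀ xs k → length xs ≤ k → padTo xs k [ k ]= 0
padTo-[]= []       zero    _           = here
padTo-[]= []       (suc k) _           = there (padTo-[]= [] k z≤n)
padTo-[]= (x ∷ xs) (suc k) (s≤s len≤k) = there (padTo-[]= xs k len≤k)

record Condition : Set where
  field
    σ τ : List ℕ

open Condition

infix 4 _≼_

_≼_ : Condition → Condition → Set
c ≼ c′ = σ c ⊑ σ c′ × τ c ⊑ τ c′

≼-refl : ∀ {c} → c ≼ c
≼-refl = ⊑-refl , ⊑-refl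

≼-trans : ∀ {c c′ c″} → c ≼ c′ → c′ ≼ c″ → c ≼ c″
≼-trans (σ⊑ , τ⊑) (σ⊑′ , τ⊑′) = ⊑-trans σ⊑ σ⊑′ , ⊑-trans τ⊑ τ⊑′

-- The shift in h = τ + 2 keeps the answers of h apart from the bits of g.
gᶜ hᶜ fᶜ oracleᶜ : Condition → PFun
gᶜ c k y = σ c [ k ]= y
hᶜ c k y = ∃ λ β → τ c [ k ]= β × y ≡ β + 2
fᶜ c ℓ y = ∃₂ λ j β → ℓ ≡ 2 * j + β × β ≤ 1 × τ c [ j ]= β × σ c [ j ]= y
oracleᶜ c = fᶜ c ⊕ (gᶜ c ∩ hᶜ c)

Monotone : (Condition → PFun) → Set
Monotone Q = ∀ {c c′} → c ≼ c′ → Q c ⇒ Q c′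

gᶜ-mono : Monotone gᶜ
gᶜ-mono (σ⊑ , _) = []=-mono σ⊑

hᶜ-mono : Monotone hᶜ
hᶜ-mono (_ , τ⊑) (β , τβ , eq) = β , []=-mono τ⊑ τβ , eq

fᶜ-mono : Monotone fᶜ
fᶜ-mono (σ⊑ , τ⊑) (j , β , eq , β≤1 , τβ , σy) = j , β , eq , β≤1 , []=-mono τ⊑ τβ , []=-mono σ⊑ σy

oracleᶜ-mono : Monotone oracleᶜ
oracleᶜ-mono {c} {c′} c≼c′ =
  ⊕-mono {fᶜ c} {fᶜ c′} {gᶜ c ∩ hᶜ c} {gᶜ c′ ∩ hᶜ c′} (fᶜ-mono c≼c′)
    (∩-mono {gᶜ c} {gᶜ c′} {hᶜ c} {hᶜ c′} (gᶜ-mono c≼c′) (hᶜ-mono c≼c′))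

2*+bit-injective : ∀ j j′ {β β′} → β ≤ 1 → β′ ≤ 1 → 2 * j + β ≡ 2 * j′ + β′ → j ≡ j′ × β ≡ β′
2*+bit-injective j j′ z≤n z≤n eq =
  *-cancelˡ-≡ j j′ 2 (trans (sym (+-identityʳ _)) (trans eq (+-identityʳ _))) , refl
2*+bit-injective j j′ z≤n (s≤s z≤n) eq = contradiction (trans (sym (+-identityʳ _)) eq) (even≢odd′ j j′)
2*+bit-injective j j′ (s≤s z≤n) z≤n eq = contradiction (trans (sym (+-identityʳ _)) (sym eq)) (even≢odd′ j′ j)
2*+bit-injective j j′ (s≤s z≤n) (s≤s z≤n) eq = odd-injective eq , refl

gᶜ-partial : ∀ c → IsPartialFun (gᶜ c)
gᶜ-partial c = []=-functional

hᶜ-partial : ∀ c → IsPartialFun (hᶜ c)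
hᶜ-partial c (_ , τβ , refl) (_ , τβ′ , refl) = cong (_+ 2) ([]=-functional τβ τβ′)

fᶜ-compatible : ∀ {c c′} → σ c ⊑ σ c′ → Compatible (fᶜ c) (fᶜ c′)
fᶜ-compatible σ⊑ (j , β , refl , β≤1 , _ , σy) (j′ , β′ , eq , β′≤1 , _ , σy′)
  with refl , refl ← 2*+bit-injective j j′ β≤1 β′≤1 eq = []=-functional ([]=-mono σ⊑ σy) σy′

fᶜ-partial : ∀ c → IsPartialFun (fᶜ c)
fᶜ-partial c = fᶜ-compatible ⊑-refl

oracleᶜ-compatible : ∀ {c c′} → σ c ⊑ σ c′ → Compatible (oracleᶜ c) (oracleᶜ c′)
oracleᶜ-compatible {c′ = c′} σ⊑ = ⊕-compatible (fᶜ-compatible σ⊑) (∩-compatibleˡ ([]=-mono σ⊑) (gᶜ-partial c′))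

-- Values of the meet are determined by its τ-side, so changing σ at k moves only f(2k + τ[k]).
oracleᶜ-compatibleOff : ∀ {c k v} → τ c [ k ]= 0 →
                        CompatibleOff (2 * (2 * k + 0)) (oracleᶜ c) (oracleᶜ (record c { σ = σ c [ k ]≔ v }))
oracleᶜ-compatibleOff {c} {k} τk≡0 =
  ⊕-compatibleOff fᶜ-compatibleOff (∩-compatibleʳ id (hᶜ-partial c))
  where
  fᶜ-compatibleOff : CompatibleOff (2 * k + 0) (fᶜ c) (fᶜ (record c { σ = σ c [ k ]≔ _ }))
  fᶜ-compatibleOff ℓ≢ (j , β , refl , β≤1 , τβ , σy) (j′ , β′ , eq , β′≤1 , _ , σy′)
    with refl , refl ← 2*+bit-injective j j′ β≤1 β′≤1 eq | j ≟ k
  ... | yes refl = contradiction (cong (2 * k +_) ([]=-functional τβ τk≡0)) ℓ≢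
  ... | no j≢k   = []=-functional σy ([]≔-other j≢k σy′)

oracleᶜ-undefined : ∀ {c k y} → τ c [ k ]= 1 → ¬ oracleᶜ c (2 * (2 * k + 0)) y
oracleᶜ-undefined {k = k} τk≡1 (inj₁ (n , eq , j , β , ℓ≡ , β≤1 , τβ , _))
  with refl ← *-cancelˡ-≡ (2 * k + 0) n 2 eq
  with refl , refl ← 2*+bit-injective k j z≤n β≤1 ℓ≡
  with () ← []=-functional τk≡1 τβ
oracleᶜ-undefined {k = k} _ (inj₂ (n , eq , _)) = even≢odd′ (2 * k + 0) n eq

probe : ℕ → ℕ
probe k = triple (decoder k) (decoder k) 0

CanConverge : ℕ → ℕ → Condition → Set
CanConverge E x c = ∃₂ λ c′ w → c ≼ c′ × Run E (oracleᶜ c′) x [] w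

Errs : ℕ → ℕ → Condition → Set
Errs E k c = ∃ λ w → Run E (oracleᶜ c) (probe k) [] w × ¬ σ c [ k ]= w

-- The two runs differ, so the first asks for f(2k), which τ[k] = 1 leaves undefined in every extension.
switch-forces-divergence : ∀ {E x c k v w w′} → τ c [ k ]= 0 → w ≢ w′ →
  Run E (oracleᶜ c) x [] w → Run E (oracleᶜ (record c { σ = σ c [ k ]≔ v })) x [] w′ →
  ¬ CanConverge E x (record c { τ = τ c [ k ]≔ 1 })
switch-forces-divergence {k = k} τk≡0 w≢w′ r r′ (c″ , _ , (σ⊑ , τ⊑) , r″) =
  let f2k-asked = different-runs-query (2 * (2 * k + 0)) (oracleᶜ-compatibleOff τk≡0) r r′ w≢w′
      _ , f2k-defined = queries-answered (oracleᶜ-compatible σ⊑) r r″ f2k-asked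
  in oracleᶜ-undefined ([]=-mono τ⊑ ([]≔-updated τk≡0)) f2k-defined

fresh : Condition → ℕ
fresh c = length (σ c) + length (τ c)

record Satisfies (E : ℕ) (c c′ : Condition) : Set where
  field
    extends : c ≼ c′
    α β     : ℕ
    α≤1     : α ≤ 1
    β≤1     : β ≤ 1
    σ-fresh : σ c′ [ fresh c ]= α
    τ-fresh : τ c′ [ fresh c ]= β
    outcome : ¬ CanConverge E (probe (fresh c)) c′ ⊎ Errs E (fresh c) c′

module Forcing (E : ℕ) (c : Condition) where

  private
    k : ℕ
    k = fresh c

    σ-short : length (σ c) ≤ k
    σ-short = m≤m+n (length (σ c)) (length (τ c))

    τ-short : length (τ c) ≤ k
    τ-short = m≤n+m (length (τ c)) (length (σ c))

    c₀ : Condition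
    c₀ = record { σ = padTo (σ c) k ; τ = padTo (τ c) k }

    c≼c₀ : c ≼ c₀
    c≼c₀ = ⊑-padTo (σ c) k , ⊑-padTo (τ c) k

    errs : ∀ {c′ α w} → Run E (oracleᶜ c′) (probe k) [] w → σ c′ [ k ]= α → w ≢ α → Errs E k c′
    errs {w = w} r σα w≢α = w , r , λ σw → w≢α ([]=-functional σw σα)

    σ-fresh₀ : ∀ {c₁} → c₀ ≼ c₁ → σ c₁ [ k ]= 0
    σ-fresh₀ (σ⊑ , _) = []=-mono σ⊑ (padTo-[]= (σ c) k σ-short)

    τ-fresh₀ : ∀ {c₁} → c₀ ≼ c₁ → τ c₁ [ k ]= 0
    τ-fresh₀ (_ , τ⊑) = []=-mono τ⊑ (padTo-[]= (τ c) k τ-short)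

    σ≔-extends : ∀ {c₁ v} → c ≼ c₁ → c ≼ record c₁ { σ = σ c₁ [ k ]≔ v }
    σ≔-extends (σ⊑ , τ⊑) = ⊑-[]≔-beyond σ⊑ σ-short , τ⊑

    τ≔-extends : ∀ {c₁ v} → c ≼ c₁ → c ≼ record c₁ { τ = τ c₁ [ k ]≔ v }
    τ≔-extends (σ⊑ , τ⊑) = σ⊑ , ⊑-[]≔-beyond τ⊑ τ-short

    after-second : ∀ c₁ → c₀ ≼ c₁ → Run E (oracleᶜ c₁) (probe k) [] 0 →
                   ∀ c₂ w₂ → record c₁ { σ = σ c₁ [ k ]≔ 1 } ≼ c₂ → Run E (oracleᶜ c₂) (probe k) [] w₂ →
                   ∃ (Satisfies E c)
    after-second c₁ c₀≼c₁ r₁ c₂ w₂ c₁′≼c₂@(σ⊑ , τ⊑) r₂ = decide r₂ (w₂ ≟ 1)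
      where
      σ₂k : σ c₂ [ k ]= 1
      σ₂k = []=-mono σ⊑ ([]≔-updated (σ-fresh₀ c₀≼c₁))

      τ₂k : τ c₂ [ k ]= 0
      τ₂k = []=-mono τ⊑ (τ-fresh₀ c₀≼c₁)

      c≼c₂ : c ≼ c₂
      c≼c₂ = ≼-trans (σ≔-extends (≼-trans c≼c₀ c₀≼c₁)) c₁′≼c₂

      c₁≼c₂′ : c₁ ≼ record c₂ { σ = σ c₂ [ k ]≔ 0 }
      c₁≼c₂′ = ⊑-[]≔-restore (σ-fresh₀ c₀≼c₁) σ⊑ , τ⊑

      decide : ∀ {w} → Run E (oracleᶜ c₂) (probe k) [] w → Dec (w ≡ 1) → ∃ (Satisfies E c)
      decide r₂ (no w≢1) = c₂ , record
        { extends = c≼c₂ ; α≤1 = s≤s z≤n ; β≤1 = z≤n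
        ; σ-fresh = σ₂k ; τ-fresh = τ₂k ; outcome = inj₂ (errs r₂ σ₂k w≢1) }
      decide r₂ (yes refl) = record c₂ { τ = τ c₂ [ k ]≔ 1 } , record
        { extends = τ≔-extends c≼c₂ ; α≤1 = s≤s z≤n ; β≤1 = s≤s z≤n
        ; σ-fresh = σ₂k ; τ-fresh = []≔-updated τ₂k
        ; outcome = inj₁ (switch-forces-divergence {c = c₂} τ₂k (λ ()) r₂
                                                   (Run-mono (oracleᶜ-mono c₁≼c₂′) r₁)) }

    after-first : ∀ c₁ → c₀ ≼ c₁ → ∀ w₁ → Run E (oracleᶜ c₁) (probe k) [] w₁ → ¬ ¬ ∃ (Satisfies E c)
    after-first c₁ c₀≼c₁ w₁ r₁ with w₁ ≟ 0
    ... | no w₁≢0 = pure (c₁ , record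
      { extends = ≼-trans c≼c₀ c₀≼c₁ ; α≤1 = z≤n ; β≤1 = z≤n
      ; σ-fresh = σ-fresh₀ c₀≼c₁ ; τ-fresh = τ-fresh₀ c₀≼c₁ ; outcome = inj₂ (errs r₁ (σ-fresh₀ c₀≼c₁) w₁≢0) })
    ... | yes refl = ¬¬-excluded-middle >>= λ where
      (no diverges) → pure (record c₁ { σ = σ c₁ [ k ]≔ 1 } , record
        { extends = σ≔-extends (≼-trans c≼c₀ c₀≼c₁) ; α≤1 = s≤s z≤n ; β≤1 = z≤n
        ; σ-fresh = []≔-updated (σ-fresh₀ c₀≼c₁) ; τ-fresh = τ-fresh₀ c₀≼c₁ ; outcome = inj₁ diverges })
      (yes (c₂ , w₂ , c₁′≼c₂ , r₂)) → pure (after-second c₁ c₀≼c₁ r₁ c₂ w₂ c₁′≼c₂ r₂)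

  ¬¬-satisfiable : ¬ ¬ ∃ (Satisfies E c)
  ¬¬-satisfiable = ¬¬-excluded-middle >>= λ where
    (no diverges) → pure (c₀ , record
      { extends = c≼c₀ ; α≤1 = z≤n ; β≤1 = z≤n
      ; σ-fresh = padTo-[]= (σ c) k σ-short ; τ-fresh = padTo-[]= (τ c) k τ-short ; outcome = inj₁ diverges })
    (yes (c₁ , w₁ , c₀≼c₁ , r₁)) → after-first c₁ c₀≼c₁ w₁ r₁

⌜_⌝ : Condition → ℕ
⌜ c ⌝ = pair (seqCode (σ c)) (seqCode (τ c))

⌜⌝-injective : ∀ {c c′} → ⌜ c ⌝ ≡ ⌜ c′ ⌝ → c ≡ c′
⌜⌝-injective {c} {c′} eq =
  let σ≡ , τ≡ = pair-injective {seqCode (σ c)} {seqCode (τ c)} {seqCode (σ c′)} {seqCode (τ c′)} eq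
  in cong₂ (λ σ τ → record { σ = σ ; τ = τ }) (seqCode-injective σ≡) (seqCode-injective τ≡)

Least : (Condition → Set) → Condition → Set
Least P c = P c × (∀ {c′} → P c′ → ⌜ c ⌝ ≤ ⌜ c′ ⌝)

Least-unique : ∀ {P c c′} → Least P c → Least P c′ → c ≡ c′
Least-unique (Pc , c-least) (Pc′ , c′-least) = ⌜⌝-injective (≤-antisym (c-least Pc′) (c′-least Pc))

module _ {P : Condition → Set} where

  ¬¬-least : ¬ ¬ ∃ P → ¬ ¬ ∃ (Least P)
  ¬¬-least ¬¬P = ¬¬P >>= λ (c , Pc) → <-rec Below-least below-least ⌜ c ⌝ c refl Pc
    where
    Below-least : ℕ → Set
    Below-least n = ∀ c → ⌜ c ⌝ ≡ n → P c → ¬ ¬ ∃ (Least P)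

    below-least : ∀ n → (∀ {m} → m < n → Below-least m) → Below-least n
    below-least _ rec c refl Pc = ¬¬-excluded-middle {A = ∃ λ c′ → P c′ × ⌜ c′ ⌝ < ⌜ c ⌝} >>= λ where
      (yes (c′ , Pc′ , c′<c)) → rec c′<c c′ refl Pc′
      (no no-smaller)         → pure (c , Pc , λ {c′} Pc′ → ≮⇒≥ (λ c′<c → no-smaller (c′ , Pc′ , c′<c)))

∅ᶜ : Condition
∅ᶜ = record { σ = [] ; τ = [] }

data Stage : ℕ → Condition → Set where
  start : Stage 0 ∅ᶜ
  next  : ∀ {s c c′} → Stage s c → Least (Satisfies s c) c′ → Stage (suc s) c′

Stage-unique : ∀ {s c c′} → Stage s c → Stage s c′ → c ≡ c′
Stage-unique start           start             = refl
Stage-unique (next st least) (next st′ least′) with refl ← Stage-unique st st′ = Least-unique least least′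

¬¬-stage : ∀ s → ¬ ¬ ∃ (Stage s)
¬¬-stage zero    = pure (∅ᶜ , start)
¬¬-stage (suc s) = do
    c , st ← ¬¬-stage s
    c′ , least ← ¬¬-least (Forcing.¬¬-satisfiable s c)
    pure (c′ , next st least)

Stage-≼ : ∀ {s t c c′} → Stage s c → Stage t c′ → s ≤′ t → c ≼ c′
Stage-≼ st st′ ≤′-refl with refl ← Stage-unique st st′ = ≼-refl
Stage-≼ st (next st′ least) (≤′-step s≤′t) = ≼-trans (Stage-≼ st st′ s≤′t) (Satisfies.extends (proj₁ least))

stages-directed : ∀ {s t c c′} → Stage s c → Stage t c′ → ∃₂ λ u d → Stage u d × c ≼ d × c′ ≼ d
stages-directed {s} {t} {c} {c′} st st′ with ≤-total s t
... | inj₁ s≤t = t , c′ , st′ , Stage-≼ st st′ (≤⇒≤′ s≤t) , ≼-refl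
... | inj₂ t≤s = s , c , st , ≼-refl , Stage-≼ st′ st (≤⇒≤′ t≤s)

⋃ : (Condition → PFun) → PFun
⋃ Q p y = ∃₂ λ s c → Stage s c × Q c p y

module _ {Q : Condition → PFun} (Q-mono : Monotone Q) where

  ⋃-partial : (∀ c → IsPartialFun (Q c)) → IsPartialFun (⋃ Q)
  ⋃-partial Q-partial (_ , _ , st , x) (_ , _ , st′ , y) =
    let _ , d , _ , c≼d , c′≼d = stages-directed st st′
    in Q-partial d (Q-mono c≼d x) (Q-mono c′≼d y)

  Run-⋃ : ∀ {e n as q} → Run e (⋃ Q) n as q → ∃₂ λ s c → Stage s c × Run e (Q c) n as q
  Run-⋃ (run-halt φ) = 0 , ∅ᶜ , start , run-halt φ
  Run-⋃ (run-query φ (_ , _ , st , x) r) =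
    let _ , _ , st′ , r′ = Run-⋃ r
        u , d , st″ , c≼d , c′≼d = stages-directed st st′
    in u , d , st″ , run-query φ (Q-mono c≼d x) (Run-mono (Q-mono c′≼d) r′)

f∞ g∞ h∞ oracle∞ : PFun
f∞ = ⋃ fᶜ
g∞ = ⋃ gᶜ
h∞ = ⋃ hᶜ
oracle∞ = f∞ ⊕ (g∞ ∩ h∞)

f∞-partial : IsPartialFun f∞
f∞-partial = ⋃-partial fᶜ-mono fᶜ-partial

g∞-partial : IsPartialFun g∞
g∞-partial = ⋃-partial gᶜ-mono gᶜ-partial

h∞-partial : IsPartialFun h∞
h∞-partial = ⋃-partial hᶜ-mono hᶜ-partial

oracle∞-partial : IsPartialFun oracle∞
oracle∞-partial = ⊕-partial {f∞} {g∞ ∩ h∞} f∞-partial (∩-partial {g∞} {h∞} g∞-partial)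

oracleᶜ⇒oracle∞ : ∀ {s c} → Stage s c → oracleᶜ c ⇒ oracle∞
oracleᶜ⇒oracle∞ {s} {c} st =
  ⊕-mono {fᶜ c} {f∞} {gᶜ c ∩ hᶜ c} {g∞ ∩ h∞} (at-stage fᶜ)
    (∩-mono {gᶜ c} {g∞} {hᶜ c} {h∞} (at-stage gᶜ) (at-stage hᶜ))
  where
  at-stage : ∀ Q → Q c ⇒ ⋃ Q
  at-stage Q x = s , c , st , x

Run-oracle∞ : ∀ {e n as q} → Run e oracle∞ n as q → ∃₂ λ s c → Stage s c × Run e (oracleᶜ c) n as q
Run-oracle∞ r = Run-⋃ oracleᶜ-mono (Run-mono oracle∞⇒⋃oracleᶜ r)
  where
  oracle∞⇒⋃oracleᶜ : oracle∞ ⇒ ⋃ oracleᶜ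
  oracle∞⇒⋃oracleᶜ (inj₁ (n , eq , s , c , st , x)) = s , c , st , inj₁ (n , eq , x)
  oracle∞⇒⋃oracleᶜ (inj₂ (n , eq , d , e , m , eqm , φ , ψ)) =
    let _ , _ , st , φ′ = Run-⋃ gᶜ-mono φ
        _ , _ , st′ , ψ′ = Run-⋃ hᶜ-mono ψ
        u , b , st″ , c≼b , c′≼b = stages-directed st st′
    in u , b , st″ , inj₂ (n , eq , d , e , m , eqm , Run-mono (gᶜ-mono c≼b) φ′ , Run-mono (hᶜ-mono c′≼b) ψ′)

meet∞ : PFun
meet∞ = (f∞ ⊕ g∞) ∩ (f∞ ⊕ h∞)

meet∞-probe : ∀ {s c k α β} → Stage s c → α ≤ 1 → β ≤ 1 → σ c [ k ]= α → τ c [ k ]= β → meet∞ (probe k) α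
meet∞-probe {s} {c} {k} {α} {β} st α≤1 β≤1 σα τβ =
  decoder k , decoder k , 0 , refl ,
  decoder-⊕ʳ {f∞} {g∞} k α α≤1 (s , c , st , σα) ,
  decoder-⊕-via {f∞} {h∞} k α β α≤1 β≤1 (s , c , st , β , τβ , refl) (s , c , st , k , β , refl , β≤1 , τβ , σα)

Satisfies⇒¬reduction : ∀ {E s c c′} → Stage s c′ → Satisfies E c c′ →
                       ¬ (∀ n y → meet∞ n y → Φ E [ oracle∞ ] n y)
Satisfies⇒¬reduction {E} {c = c} {c′} st sat reduces = refute outcome
  where
  open Satisfies sat

  r : Run E oracle∞ (probe (fresh c)) [] α
  r = reduces (probe (fresh c)) α (meet∞-probe st α≤1 β≤1 σ-fresh τ-fresh)

  refute : ¬ (¬ CanConverge E (probe (fresh c)) c′ ⊎ Errs E (fresh c) c′)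
  refute (inj₁ diverges) =
    let _ , _ , st′ , r′ = Run-oracle∞ r
        _ , b , _ , c′≼b , c″≼b = stages-directed st st′
    in diverges (b , α , c′≼b , Run-mono (oracleᶜ-mono c″≼b) r′)
  refute (inj₂ (w , r′ , σ≢w)) =
    let α≡w = Run-functional oracle∞-partial r (Run-mono (oracleᶜ⇒oracle∞ st) r′)
    in σ≢w (subst (σ c′ [ fresh c ]=_) α≡w σ-fresh)

meet∞≰oracle∞ : ¬ (meet∞ ≤subT oracle∞)
meet∞≰oracle∞ (E , reduces) = ¬¬-stage (suc E) λ where
  (_ , st@(next _ (sat , _))) → Satisfies⇒¬reduction st sat reduces

theorem4p9 : Σ PFun λ f → Σ PFun λ g → Σ PFun λ h →
    IsPartialFun f × IsPartialFun g × IsPartialFun h ×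
    ¬ ((f ⊕ (g ∩ h)) ≡subT ((f ⊕ g) ∩ (f ⊕ h)))
theorem4p9 =
  f∞ , g∞ , h∞ , f∞-partial , g∞-partial , h∞-partial , λ (_ , meet≤oracle) → meet∞≰oracle∞ meet≤oracle
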